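{- Fix any $1\le i\le h$ and let $[b,e]$ be any haplotype interval of $S_i$. Then either the values $\phi_j(i)$ are all equal for $j\in[b,e]$, or $\mathrm{col}_j(\mathrm{PA})[1]=i$ holds for all $j\in[b,e]$.
   Context: A haplotype panel consists of $h$ strings $S_1,\dots,S_h$ (not necessarily distinct), each of length $m$, over a totally ordered alphabet. The prefix array $\mathrm{PA}$ is an $h\times m$ matrix whose column $1$ is $1,\dots,h$ and whose column $j>1$ lists the haplotype indices sorted by the co-lexicographic order of the prefixes $S_1[1..j-1],\dots,S_h[1..j-1]$ (co-lexicographic = lexicographic comparison of the reversed strings, a proper suffix being smaller; ties broken stably, consistently with column $j-1$). The PBWT is the $h\times m$ matrix with $\mathrm{col}_j(\mathrm{PBWT})[x]=S_{\mathrm{col}_j(\mathrm{PA})[x]}[j]$. A pair $(x,j)$ is a run-top if $x=1$ or $\mathrm{col}_j(\mathrm{PBWT})[x]\ne\mathrm{col}_j(\mathrm{PBWT})[x-1]$. For $j\in[1,m]$ and $i\in[1,h]$ with $\mathrm{col}_j(\mathrm{PA})[x]=i$, $\phi_j(i)=0$ if $x=1$, else $\phi_j(i)=\mathrm{col}_j(\mathrm{PA})[x-1]$. Haplotype intervals of $S_i$: let $b_1<\dots<b_k=m$ be the sorted set consisting of $m$ together with all columns $j$ for which there is a row $x$ with $(x,j)$ a run-top and $\mathrm{col}_j(\mathrm{PA})[x]=i$; the haplotype intervals of $S_i$ are $[1,b_1],[b_1+1,b_2],\dots,[b_{k-1}+1,b_k]$. -}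

module Defs where

open import Data.Nat using (ℕ; zero; suc; _<_; _≤_)
open import Data.Fin using (Fin; toℕ; inject₁)
import Data.Fin as F
open import Data.List using (List; take; reverse; tabulate)
open import Data.List.Relation.Binary.Lex.Strict using (Lex-<)
open import Data.Fin.Permutation using (Permutation′; _⟨$⟩ʳ_; _⟨$⟩ˡ_)
open import Data.Maybe using (Maybe; nothing; just)
open import Data.Product using (_×_; ∃)
open import Data.Sum using (_⊎_)
open import Relation.Binary.PropositionalEquality using (_≡_; _≢_)
open import Relation.Nullary using (¬_)

-- Conventions: haplotypes are indexed by Fin h (Fin.zero = haplotype 1),
-- columns by Fin m (column c : Fin m is the paper's column toℕ c + 1),
-- PA rows (positions) by Fin h (position zero = row 1).
Panel : Set → ℕ → ℕ → Set
Panel A h m = Fin h → Fin m → A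

module _ {A : Set} (_≺_ : A → A → Set) {h m : ℕ} (S : Panel A h m) where

  row : Fin h → List A
  row i = tabulate (S i)

  prefix : ℕ → Fin h → List A
  prefix k i = take k (row i)

  -- co-lexicographic strict order on the prefixes of length k:
  -- lexicographic order of the reversed strings (proper prefix of the
  -- reversal, i.e. proper suffix, is smaller)
  ColexLt : ℕ → Fin h → Fin h → Set
  ColexLt k i i' = Lex-< _≡_ _≺_ (reverse (prefix k i)) (reverse (prefix k i'))

  -- Order of haplotype indices in the column whose prefixes have length k
  -- (i.e. paper's column k+1): k = 0 is the identity order 1..h;
  -- for k > 0 co-lex order of the length-k prefixes, ties broken stably,
  -- consistently with the order of the previous column.
  ColOrd : ℕ → Fin h → Fin h → Set
  ColOrd zero i i' = toℕ i < toℕ i'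
  ColOrd (suc k) i i' =
    ColexLt (suc k) i i' ⊎ (prefix (suc k) i ≡ prefix (suc k) i' × ColOrd k i i')

  -- PA c ⟨$⟩ʳ x = col_c(PA)[x] (index at position x),
  -- PA c ⟨$⟩ˡ i = position of haplotype i in column c.
  -- IsPrefixArray PA : every column lists the indices in the order above.
  IsPrefixArray : (Fin m → Permutation′ h) → Set
  IsPrefixArray PA = ∀ (c : Fin m) (x y : Fin h) → toℕ x < toℕ y →
    ColOrd (toℕ c) (PA c ⟨$⟩ʳ x) (PA c ⟨$⟩ʳ y)

  module _ (PA : Fin m → Permutation′ h) where

    PBWT : Fin m → Fin h → A
    PBWT c x = S (PA c ⟨$⟩ʳ x) c

    RunTop : Fin h → Fin m → Set
    RunTop F.zero c = Data.Unit.⊤ where import Data.Unit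
    RunTop (F.suc x) c = PBWT c (F.suc x) ≢ PBWT c (inject₁ x)

    -- φ_c(i); nothing plays the role of 0
    phiAt : Fin m → Fin h → Maybe (Fin h)
    phiAt c i = go (PA c ⟨$⟩ˡ i)
      where
      go : Fin h → Maybe (Fin h)
      go F.zero = nothing
      go (F.suc x) = just (PA c ⟨$⟩ʳ inject₁ x)

    Boundary : Fin h → Fin m → Set
    Boundary i c = suc (toℕ c) ≡ m ⊎ ∃ λ (x : Fin h) → RunTop x c × PA c ⟨$⟩ʳ x ≡ i

    HapInterval : Fin h → Fin m → Fin m → Set
    HapInterval i b e =
      toℕ b ≤ toℕ e × Boundary i e ×
      ( (toℕ b ≡ 0 × (∀ (c : Fin m) → toℕ c < toℕ e → ¬ Boundary i c))
      ⊎ ∃ λ (b' : Fin m) → suc (toℕ b') ≡ toℕ b × Boundary i b' ×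
          (∀ (c : Fin m) → toℕ b' < toℕ c → toℕ c < toℕ e → ¬ Boundary i c))

    FirstIs : Fin m → Fin h → Set
    FirstIs c i = ∃ λ (x : Fin h) → toℕ x ≡ 0 × PA c ⟨$⟩ʳ x ≡ i

-- Row 1 of every column is a run-top, so at every column c of a haplotype interval other
-- than its last one, S_i is not on row 1 and shares its letter at c with the haplotype p
-- directly above it.  Appending this common letter keeps p before S_i in column c + 1, and a
-- haplotype sorted between them there would have to carry the same letter, hence lie between
-- them already in column c.  So p stays the predecessor of S_i and φ is constant on the
-- interval: the first alternative always holds.

module Submission where

open import Defs
open import Data.Nat using (ℕ; zero; suc; _≤_; _<_; s≤s⁻¹)
open import Data.Nat.Properties
  using ( <-cmp; <-asym; <-irrefl; <-trans; <-≤-trans; <⇒≤; ≤-refl; ≤-reflexive; ≤-antisym; ≮⇒≥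
        ; m≤n⇒m<n∨m≡n; n≤0⇒n≡0; suc-injective)
open import Data.Fin using (Fin; toℕ; inject₁; fromℕ<)
import Data.Fin as F
open import Data.Fin.Properties using (toℕ-injective; toℕ-inject₁; toℕ-fromℕ<; toℕ<n; ≤̄⇒inject₁<)
open import Data.Fin.Induction using (<-weakInduction)
open import Data.Fin.Permutation using (Permutation′; _⟨$⟩ʳ_; _⟨$⟩ˡ_; inverseʳ; inverseˡ)
open import Data.List using (List; _∷_; _∷ʳ_; [_]; reverse)
open import Data.List.Properties using (take-suc-tabulate; reverse-++; ∷-injectiveˡ)
open import Data.List.Relation.Binary.Lex.Strict using (Lex-<; base; this; next; <-isStrictPartialOrder)
open import Data.List.Relation.Binary.Pointwise using (≡⇒Pointwise-≡)
open import Data.Product using (_×_; _,_; ∃)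
open import Data.Sum using (_⊎_; inj₁; inj₂)
open import Data.Empty using (⊥; ⊥-elim)
open import Data.Maybe using (just)
open import Data.Unit using (tt)
open import Function using (_∘_)
open import Relation.Nullary using (¬_)
open import Relation.Nullary.Decidable using (decidable-stable)
open import Relation.Binary.Definitions using (Asymmetric; tri<; tri≈; tri>)
open import Relation.Binary.PropositionalEquality
  using (_≡_; refl; sym; trans; cong; cong₂; subst; subst₂; module ≡-Reasoning)
open import Relation.Binary.Structures using (IsStrictTotalOrder; IsStrictPartialOrder)
import Relation.Binary.Construct.StrictToNonStrict as StrictToNonStrict

constant-on-range : ∀ {m} {B : Set} (f : Fin m → B) (b e : Fin m) →
  (∀ c c′ → toℕ b ≤ toℕ c → toℕ c′ ≡ suc (toℕ c) → toℕ c′ ≤ toℕ e → f c′ ≡ f c) →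
  ∀ j → toℕ b ≤ toℕ j → toℕ j ≤ toℕ e → f j ≡ f b
constant-on-range {suc _} f b e step = <-weakInduction P zero-case suc-case
  where
  P : Fin _ → Set
  P j = toℕ b ≤ toℕ j → toℕ j ≤ toℕ e → f j ≡ f b

  zero-case : P F.zero
  zero-case b≤0 _ = cong f (toℕ-injective (sym (n≤0⇒n≡0 b≤0)))

  suc-case : ∀ c → P (inject₁ c) → P (F.suc c)
  suc-case c ih b≤1+c 1+c≤e with m≤n⇒m<n∨m≡n b≤1+c
  ... | inj₂ b≡1+c = cong f (toℕ-injective (sym b≡1+c))
  ... | inj₁ b<1+c =
    trans (step (inject₁ c) (F.suc c) b≤c (cong suc (sym (toℕ-inject₁ c))) 1+c≤e)
          (ih b≤c (<⇒≤ (<-≤-trans (≤̄⇒inject₁< ≤-refl) 1+c≤e)))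
    where
    b≤c : toℕ b ≤ toℕ (inject₁ c)
    b≤c = subst (toℕ b ≤_) (sym (toℕ-inject₁ c)) (s≤s⁻¹ b<1+c)

module ColumnOrder {A : Set} {_≺_ : A → A → Set} (≺-sto : IsStrictTotalOrder _≡_ _≺_)
                   {h m : ℕ} (S : Panel A h m) where

  open IsStrictTotalOrder ≺-sto using (isStrictPartialOrder; isEquivalence; irrefl)
    renaming (trans to ≺-trans)
  open StrictToNonStrict _≡_ _≺_ public using () renaming (_≤_ to _⪯_)

  private
    module Lex = IsStrictPartialOrder
      (<-isStrictPartialOrder {_≈_ = _≡_} {_≺_ = _≺_} isStrictPartialOrder)

  lex-irrefl : ∀ {xs ys : List A} → xs ≡ ys → ¬ Lex-< _≡_ _≺_ xs ys
  lex-irrefl xs≡ys = Lex.irrefl (≡⇒Pointwise-≡ xs≡ys)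

  ⪯-antisym : ∀ {a b} → a ⪯ b → b ⪯ a → a ≡ b
  ⪯-antisym = StrictToNonStrict.antisym _≡_ _≺_ isEquivalence ≺-trans irrefl

  colOrd-asym : ∀ k → Asymmetric (ColOrd _≺_ S k)
  colOrd-asym zero = <-asym
  colOrd-asym (suc k) (inj₁ p<z) (inj₁ z<p)       = Lex.asym p<z z<p
  colOrd-asym (suc k) (inj₁ p<z) (inj₂ (z≡p , _)) = lex-irrefl (cong reverse (sym z≡p)) p<z
  colOrd-asym (suc k) (inj₂ (p≡z , _)) (inj₁ z<p) = lex-irrefl (cong reverse (sym p≡z)) z<p
  colOrd-asym (suc k) (inj₂ (_ , p<z)) (inj₂ (_ , z<p)) = colOrd-asym k p<z z<p

  colexLt⇒colOrd : ∀ k {p z} → ColexLt _≺_ S k p z → ColOrd _≺_ S k p z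
  colexLt⇒colOrd zero    (base ())
  colexLt⇒colOrd (suc k) p<z = inj₁ p<z

  colOrd⇒colexLt⊎≡ : ∀ k {p z} → ColOrd _≺_ S k p z →
    ColexLt _≺_ S k p z ⊎ prefix _≺_ S k p ≡ prefix _≺_ S k z
  colOrd⇒colexLt⊎≡ zero    _                = inj₂ refl
  colOrd⇒colexLt⊎≡ (suc k) (inj₁ p<z)       = inj₁ p<z
  colOrd⇒colexLt⊎≡ (suc k) (inj₂ (p≡z , _)) = inj₂ p≡z

  module _ (c : Fin m) where

    prefix-suc : ∀ p → prefix _≺_ S (suc (toℕ c)) p ≡ prefix _≺_ S (toℕ c) p ∷ʳ S p c
    prefix-suc p = take-suc-tabulate (S p) c

    reversed-prefix : Fin h → List A
    reversed-prefix p = reverse (prefix _≺_ S (toℕ c) p)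

    reverse-prefix-suc : ∀ p → reverse (prefix _≺_ S (suc (toℕ c)) p) ≡ S p c ∷ reversed-prefix p
    reverse-prefix-suc p =
      trans (cong reverse (prefix-suc p)) (reverse-++ (prefix _≺_ S (toℕ c) p) [ S p c ])

    unfold-colexLt : ∀ {p z} → ColexLt _≺_ S (suc (toℕ c)) p z →
      Lex-< _≡_ _≺_ (S p c ∷ reversed-prefix p) (S z c ∷ reversed-prefix z)
    unfold-colexLt {p} {z} = subst₂ (Lex-< _≡_ _≺_) (reverse-prefix-suc p) (reverse-prefix-suc z)

    fold-colexLt : ∀ {p z} →
      Lex-< _≡_ _≺_ (S p c ∷ reversed-prefix p) (S z c ∷ reversed-prefix z) →
      ColexLt _≺_ S (suc (toℕ c)) p z
    fold-colexLt {p} {z} =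
      subst₂ (Lex-< _≡_ _≺_) (sym (reverse-prefix-suc p)) (sym (reverse-prefix-suc z))

    colOrd-suc⇒⪯ : ∀ {p z} → ColOrd _≺_ S (suc (toℕ c)) p z → S p c ⪯ S z c
    colOrd-suc⇒⪯ (inj₁ p<z) with unfold-colexLt p<z
    ... | this sp<sz   = inj₁ sp<sz
    ... | next sp≡sz _ = inj₂ sp≡sz
    colOrd-suc⇒⪯ {p} {z} (inj₂ (p≡z , _)) = inj₂ (∷-injectiveˡ (begin
      S p c ∷ reversed-prefix p               ≡⟨ reverse-prefix-suc p ⟨
      reverse (prefix _≺_ S (suc (toℕ c)) p)  ≡⟨ cong reverse p≡z ⟩
      reverse (prefix _≺_ S (suc (toℕ c)) z)  ≡⟨ reverse-prefix-suc z ⟩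
      S z c ∷ reversed-prefix z               ∎))
      where open ≡-Reasoning

    colOrd-suc⇒colOrd : ∀ {p z} → S p c ≡ S z c →
      ColOrd _≺_ S (suc (toℕ c)) p z → ColOrd _≺_ S (toℕ c) p z
    colOrd-suc⇒colOrd same (inj₁ p<z) with unfold-colexLt p<z
    ... | this sp<sz  = ⊥-elim (irrefl same sp<sz)
    ... | next _ p<z′ = colexLt⇒colOrd (toℕ c) p<z′
    colOrd-suc⇒colOrd same (inj₂ (_ , p<z)) = p<z

    colOrd⇒colOrd-suc : ∀ {p z} → S p c ≡ S z c →
      ColOrd _≺_ S (toℕ c) p z → ColOrd _≺_ S (suc (toℕ c)) p z
    colOrd⇒colOrd-suc {p} {z} same p<z with colOrd⇒colexLt⊎≡ (toℕ c) p<z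
    ... | inj₁ p<z′ = inj₁ (fold-colexLt (next same p<z′))
    ... | inj₂ p≡z  =
      inj₂ (subst₂ _≡_ (sym (prefix-suc p)) (sym (prefix-suc z)) (cong₂ _∷ʳ_ p≡z same) , p<z)

module PrefixArray {A : Set} {_≺_ : A → A → Set} (≺-sto : IsStrictTotalOrder _≡_ _≺_)
                   {h m : ℕ} (S : Panel A h m) (PA : Fin m → Permutation′ h)
                   (isPA : IsPrefixArray _≺_ S PA) where

  open ColumnOrder ≺-sto S
  open IsStrictTotalOrder ≺-sto using (_≟_)

  pos : Fin m → Fin h → Fin h
  pos c i = PA c ⟨$⟩ˡ i

  pos<⇒colOrd : ∀ {c p z} → toℕ (pos c p) < toℕ (pos c z) → ColOrd _≺_ S (toℕ c) p z
  pos<⇒colOrd {c} p<z =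
    subst₂ (ColOrd _≺_ S (toℕ c)) (inverseʳ (PA c)) (inverseʳ (PA c)) (isPA c _ _ p<z)

  pos-injective : ∀ {c p z} → toℕ (pos c p) ≡ toℕ (pos c z) → p ≡ z
  pos-injective {c} {p} {z} p≡z = begin
    p                   ≡⟨ inverseʳ (PA c) ⟨
    PA c ⟨$⟩ʳ pos c p  ≡⟨ cong (PA c ⟨$⟩ʳ_) (toℕ-injective p≡z) ⟩
    PA c ⟨$⟩ʳ pos c z  ≡⟨ inverseʳ (PA c) ⟩
    z                   ∎
    where open ≡-Reasoning

  colOrd⇒pos< : ∀ {c p z} → ColOrd _≺_ S (toℕ c) p z → toℕ (pos c p) < toℕ (pos c z)
  colOrd⇒pos< {c} {p} {z} p<z with <-cmp (toℕ (pos c p)) (toℕ (pos c z))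
  ... | tri< lt _ _ = lt
  ... | tri≈ _ eq _ with refl ← pos-injective {c} eq = ⊥-elim (colOrd-asym (toℕ c) p<z p<z)
  ... | tri> _ _ gt = ⊥-elim (colOrd-asym (toℕ c) p<z (pos<⇒colOrd gt))

  Predecessor : Fin m → Fin h → Fin h → Set
  Predecessor c p i = toℕ (pos c i) ≡ suc (toℕ (pos c p))

  phiAt-predecessor : ∀ {c p i} → Predecessor c p i → phiAt _≺_ S PA c i ≡ just p
  phiAt-predecessor {c} {p} {i} p↑i with pos c i | p↑i
  ... | F.suc x | 1+x≡1+p = cong just (begin
    PA c ⟨$⟩ʳ inject₁ x
      ≡⟨ cong (PA c ⟨$⟩ʳ_) (toℕ-injective (trans (toℕ-inject₁ x) (suc-injective 1+x≡1+p))) ⟩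
    PA c ⟨$⟩ʳ pos c p    ≡⟨ inverseʳ (PA c) ⟩
    p                     ∎)
    where open ≡-Reasoning

  row-of-pos : ∀ {c i x} → pos c i ≡ x → PA c ⟨$⟩ʳ x ≡ i
  row-of-pos {c} i-at-x = trans (cong (PA c ⟨$⟩ʳ_) (sym i-at-x)) (inverseʳ (PA c))

  nonBoundary⇒predecessor : ∀ {c i} → ¬ Boundary _≺_ S PA i c →
    ∃ λ p → Predecessor c p i × S p c ≡ S i c
  nonBoundary⇒predecessor {c} {i} i∉B = at-row (pos c i) refl
    where
    at-row : ∀ x → pos c i ≡ x → ∃ λ p → Predecessor c p i × S p c ≡ S i c
    at-row F.zero    i-at-0   = ⊥-elim (i∉B (inj₂ (F.zero , tt , row-of-pos i-at-0)))
    at-row (F.suc x) i-at-1+x = p , p↑i , same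
      where
      open ≡-Reasoning
      p : Fin h
      p = PA c ⟨$⟩ʳ inject₁ x

      p↑i : Predecessor c p i
      p↑i = begin
        toℕ (pos c i)             ≡⟨ cong toℕ i-at-1+x ⟩
        suc (toℕ x)               ≡⟨ cong suc (toℕ-inject₁ x) ⟨
        suc (toℕ (inject₁ x))     ≡⟨ cong (suc ∘ toℕ) (inverseˡ (PA c)) ⟨
        suc (toℕ (pos c p))       ∎

      same : S p c ≡ S i c
      same = subst (λ j → S p c ≡ S j c) (row-of-pos i-at-1+x)
        (decidable-stable (S p c ≟ S (PA c ⟨$⟩ʳ F.suc x) c)
          (λ p≢1+x → i∉B (inj₂ (F.suc x , p≢1+x ∘ sym , row-of-pos i-at-1+x))))

  gap⇒between : ∀ {c p i} → suc (toℕ (pos c p)) < toℕ (pos c i) →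
    ∃ λ z → toℕ (pos c p) < toℕ (pos c z) × toℕ (pos c z) < toℕ (pos c i)
  gap⇒between {c} {p} {i} gap =
    z , ≤-reflexive (sym pos-z) , subst (_< toℕ (pos c i)) (sym pos-z) gap
    where
    y : Fin h
    y = fromℕ< (<-trans gap (toℕ<n (pos c i)))
    z : Fin h
    z = PA c ⟨$⟩ʳ y
    pos-z : toℕ (pos c z) ≡ suc (toℕ (pos c p))
    pos-z = trans (cong toℕ (inverseˡ (PA c))) (toℕ-fromℕ< _)

  module _ {c c′ : Fin m} (c′≡1+c : toℕ c′ ≡ suc (toℕ c)) where

    colOrd-suc⇒pos< : ∀ {p z} →
      ColOrd _≺_ S (suc (toℕ c)) p z → toℕ (pos c′ p) < toℕ (pos c′ z)
    colOrd-suc⇒pos< {p} {z} = colOrd⇒pos< ∘ subst (λ k → ColOrd _≺_ S k p z) (sym c′≡1+c)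

    pos<⇒colOrd-suc : ∀ {p z} →
      toℕ (pos c′ p) < toℕ (pos c′ z) → ColOrd _≺_ S (suc (toℕ c)) p z
    pos<⇒colOrd-suc {p} {z} = subst (λ k → ColOrd _≺_ S k p z) c′≡1+c ∘ pos<⇒colOrd

    nothing-between : ∀ {p i z} → Predecessor c p i → S p c ≡ S i c →
      toℕ (pos c′ p) < toℕ (pos c′ z) → toℕ (pos c′ z) < toℕ (pos c′ i) → ⊥
    nothing-between {p} {i} {z} p↑i same p<z z<i =
      <-irrefl refl (<-≤-trans p<z₀ (s≤s⁻¹ z<1+p₀))
      where
      p≺z : ColOrd _≺_ S (suc (toℕ c)) p z
      p≺z = pos<⇒colOrd-suc p<z
      z≺i : ColOrd _≺_ S (suc (toℕ c)) z i
      z≺i = pos<⇒colOrd-suc z<i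
      z≡p : S z c ≡ S p c
      z≡p = sym (⪯-antisym (colOrd-suc⇒⪯ c p≺z)
                           (subst (S z c ⪯_) (sym same) (colOrd-suc⇒⪯ c z≺i)))
      p<z₀ : toℕ (pos c p) < toℕ (pos c z)
      p<z₀ = colOrd⇒pos< (colOrd-suc⇒colOrd c (sym z≡p) p≺z)
      z<1+p₀ : toℕ (pos c z) < suc (toℕ (pos c p))
      z<1+p₀ = subst (toℕ (pos c z) <_) p↑i
        (colOrd⇒pos< (colOrd-suc⇒colOrd c (trans z≡p same) z≺i))

    predecessor-preserved : ∀ {p i} → Predecessor c p i → S p c ≡ S i c → Predecessor c′ p i
    predecessor-preserved {p} {i} p↑i same = ≤-antisym (≮⇒≥ no-gap) p<i
      where
      p<i : toℕ (pos c′ p) < toℕ (pos c′ i)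
      p<i = colOrd-suc⇒pos< (colOrd⇒colOrd-suc c same (pos<⇒colOrd (≤-reflexive (sym p↑i))))
      no-gap : ¬ suc (toℕ (pos c′ p)) < toℕ (pos c′ i)
      no-gap gap with z , p<z , z<i ← gap⇒between gap = nothing-between p↑i same p<z z<i

    phiAt-suc : ∀ {i} → ¬ Boundary _≺_ S PA i c → phiAt _≺_ S PA c′ i ≡ phiAt _≺_ S PA c i
    phiAt-suc i∉B with p , p↑i , same ← nonBoundary⇒predecessor i∉B =
      trans (phiAt-predecessor (predecessor-preserved p↑i same)) (sym (phiAt-predecessor p↑i))

  hapInterval⇒nonBoundary : ∀ {i b e c} → HapInterval _≺_ S PA i b e →
    toℕ b ≤ toℕ c → toℕ c < toℕ e → ¬ Boundary _≺_ S PA i c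
  hapInterval⇒nonBoundary (_ , _ , inj₁ (_ , none-before-e)) _ c<e = none-before-e _ c<e
  hapInterval⇒nonBoundary (_ , _ , inj₂ (_ , 1+b′≡b , _ , none-between)) b≤c c<e =
    none-between _ (subst (_≤ _) (sym 1+b′≡b) b≤c) c<e

  phiAt-constant : ∀ {i b e} → HapInterval _≺_ S PA i b e →
    ∀ j → toℕ b ≤ toℕ j → toℕ j ≤ toℕ e → phiAt _≺_ S PA j i ≡ phiAt _≺_ S PA b i
  phiAt-constant {i} {b} {e} hi = constant-on-range (λ j → phiAt _≺_ S PA j i) b e
    λ c c′ b≤c c′≡1+c c′≤e →
      phiAt-suc c′≡1+c (hapInterval⇒nonBoundary hi b≤c (subst (_≤ toℕ e) c′≡1+c c′≤e))

proposition3 : {A : Set} (_≺_ : A → A → Set) → IsStrictTotalOrder _≡_ _≺_ →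
    (h m : ℕ) (S : Panel A h m) (PA : Fin m → Permutation′ h) →
    IsPrefixArray _≺_ S PA →
    (i : Fin h) (b e : Fin m) → HapInterval _≺_ S PA i b e →
    (∀ (j j' : Fin m) → toℕ b ≤ toℕ j → toℕ j ≤ toℕ e → toℕ b ≤ toℕ j' → toℕ j' ≤ toℕ e →
       phiAt _≺_ S PA j i ≡ phiAt _≺_ S PA j' i)
    ⊎ (∀ (j : Fin m) → toℕ b ≤ toℕ j → toℕ j ≤ toℕ e → FirstIs _≺_ S PA j i)
proposition3 _≺_ ≺-sto h m S PA isPA i b e hi =
  inj₁ λ j j′ b≤j j≤e b≤j′ j′≤e →
    trans (phiAt-constant hi j b≤j j≤e) (sym (phiAt-constant hi j′ b≤j′ j′≤e))
  where open PrefixArray ≺-sto S PA isPA
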